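{- For every integer $n\ge5$, the flip graph $\mathcal{D}_n$ on ordered pairs of disjoint triangulations of a convex $n$-gon is simple and $2(n-3)$-regular.
   Context: Label the vertices of a convex $n$-gon by $1,\dots,n$. A triangulation is a maximal set of pairwise noncrossing diagonals; two triangulations are disjoint if they share no diagonal. If $(a,b)$ is a diagonal of a triangulation $T$, deleting it leaves a unique quadrilateral $(a,a',b,b')$; the flip of $T$ at $(a,b)$ replaces $(a,b)$ by $(a',b')$. For an ordered pair $(T_1,T_2)$ of disjoint triangulations and a diagonal $(a,b)\in T_i$, the flip at $(a,b)_i$ is: (a) flip $(a,b)$ in $T_i$, obtaining a new diagonal $(a',b')$; (b) if $(a',b')\in T_j$ with $j\ne i$, then also flip $(a',b')$ in $T_j$. The flip graph $\mathcal{D}_n$ is the graph whose vertices are the ordered pairs of disjoint triangulations of the $n$-gon, with an edge between two pairs whenever one is obtained from the other by a flip (there is one flip for each of the $2(n-3)$ diagonals of $T_1$ and $T_2$). -}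

module Defs where

open import Data.Nat using (ℕ; zero; suc; _<_; _≤_; _<ᵇ_)
open import Data.Fin using (Fin; toℕ)
import Data.Fin as F
open import Data.Vec using (Vec; lookup; tabulate)
open import Data.Bool using (Bool; true; false; if_then_else_; _∧_)
open import Data.Product using (Σ; ∃; ∃-syntax; _×_; _,_; proj₁; proj₂)
open import Data.Sum using (_⊎_)
open import Relation.Nullary using (¬_)
open import Data.Empty using (⊥)
open import Relation.Nullary.Decidable using (⌊_⌋)
open import Relation.Binary.PropositionalEquality using (_≡_)

-- Vertices 1..n of the convex n-gon are represented by Fin n (labels 0..n-1),
-- in cyclic order.

-- A set of (unordered) pairs of vertices, stored as a Boolean matrix; by
-- convention only entries (a , b) with a < b are ever used (enforced by
-- IsTriangulation), so propositional equality of DSets is set equality.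
DSet : ℕ → Set
DSet n = Vec (Vec Bool n) n

module _ {n : ℕ} where

  mem : DSet n → Fin n → Fin n → Set
  mem S a b = lookup (lookup S a) b ≡ true

  In : DSet n → Fin n → Fin n → Set
  In S x y = mem S x y ⊎ mem S y x

  IsDiag : Fin n → Fin n → Set
  IsDiag a b = (suc (toℕ a) < toℕ b) × (0 < toℕ a ⊎ suc (toℕ b) < n)

  Side : Fin n → Fin n → Set
  Side x y = (suc (toℕ x) ≡ toℕ y) ⊎ (suc (toℕ y) ≡ toℕ x)
           ⊎ ((toℕ x ≡ 0) × (suc (toℕ y) ≡ n)) ⊎ ((toℕ y ≡ 0) × (suc (toℕ x) ≡ n))

  Crosses : Fin n → Fin n → Fin n → Fin n → Set
  Crosses a b c d =
      (toℕ a < toℕ c × toℕ c < toℕ b × toℕ b < toℕ d)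
    ⊎ (toℕ c < toℕ a × toℕ a < toℕ d × toℕ d < toℕ b)

  IsTriangulation : DSet n → Set
  IsTriangulation S =
      (∀ a b → mem S a b → toℕ a < toℕ b × IsDiag a b)
    × (∀ a b c d → mem S a b → mem S c d → ¬ Crosses a b c d)
    × (∀ c d → toℕ c < toℕ d → IsDiag c d → ¬ mem S c d →
         ∃[ a ] ∃[ b ] (mem S a b × Crosses a b c d))

  Disjoint : DSet n → DSet n → Set
  Disjoint S T = ∀ a b → mem S a b → mem T a b → ⊥

  Bound : DSet n → Fin n → Fin n → Set
  Bound T x y = Side x y ⊎ In T x y

  -- Deleting the diagonal (a , b), a < b, of T leaves the quadrilateral
  -- (a , a' , b , b'): a' is the third vertex of the triangle of T on the
  -- side a < a' < b, b' the third vertex of the triangle on the other side.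
  Quad : DSet n → Fin n → Fin n → Fin n → Fin n → Set
  Quad T a b a' b' =
      (toℕ a < toℕ a' × toℕ a' < toℕ b)
    × (toℕ b < toℕ b' ⊎ toℕ b' < toℕ a)
    × Bound T a a' × Bound T a' b × Bound T b b' × Bound T b' a

  norm : Fin n → Fin n → Fin n × Fin n
  norm x y = if toℕ x <ᵇ toℕ y then (x , y) else (y , x)

  setAt : DSet n → Fin n → Fin n → Bool → DSet n
  setAt S a b v = tabulate λ i → tabulate λ j →
    if ⌊ i F.≟ a ⌋ ∧ ⌊ j F.≟ b ⌋ then v else lookup (lookup S i) j

  replace : DSet n → Fin n → Fin n → Fin n × Fin n → DSet n
  replace S a b p = setAt (setAt S a b false) (proj₁ p) (proj₂ p) true

  FlipT : DSet n → Fin n → Fin n → Fin n → Fin n → DSet n → Set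
  FlipT T a b c d T' = mem T a b × ∃[ a' ] ∃[ b' ]
    (Quad T a b a' b' × norm a' b' ≡ (c , d) × T' ≡ replace T a b (c , d))

data Which : Set where
  one two : Which

other : Which → Which
other one = two
other two = one

Pair : ℕ → Set
Pair n = DSet n × DSet n

comp : ∀ {n} → Pair n → Which → DSet n
comp P one = proj₁ P
comp P two = proj₂ P

module _ {n : ℕ} where

  IsVertex : Pair n → Set
  IsVertex P = IsTriangulation (proj₁ P) × IsTriangulation (proj₂ P)
             × Disjoint (proj₁ P) (proj₂ P)

  PairFlip : Pair n → Which → Fin n → Fin n → Pair n → Set
  PairFlip P i a b Q = ∃[ c ] ∃[ d ]
      (FlipT (comp P i) a b c d (comp Q i)
    × ((mem (comp P (other i)) c d × ∃[ c' ] ∃[ d' ]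
          FlipT (comp P (other i)) c d c' d' (comp Q (other i)))
      ⊎ (¬ mem (comp P (other i)) c d × comp Q (other i) ≡ comp P (other i))))

  Adj : Pair n → Pair n → Set
  Adj P Q = IsVertex P × IsVertex Q ×
    ((∃[ i ] ∃[ a ] ∃[ b ] PairFlip P i a b Q)
     ⊎ (∃[ i ] ∃[ a ] ∃[ b ] PairFlip Q i a b P))

-- A diagonal (a , b) of a triangulation T lies in a unique quadrilateral (a , a′ , b , b′) of T:
-- a′ is the apex of the triangle on the inner side of (a , b), and b′ the apex on the outer
-- side, found by decomposing the whole polygon into triangles, which also shows that every
-- triangulation has exactly n - 3 diagonals.  Swapping the diagonals of that quadrilateral gives
-- a triangulation in which the new diagonal (c , d) flips straight back, so a flip is determined
-- by the diagonal it removes and distinct diagonals give distinct flips.  The new pair is again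
-- disjoint: the partner gives up (c , d) if it had it, and the diagonal it gains instead crosses
-- (c , d).  A flip in T and a flip in U never reach the same pair: each would have to create the
-- diagonal the other removes, so T and U would share the quadrilateral around it, all of whose
-- sides would then be polygon sides, which forces n = 4.  Hence the 2(n - 3) flips of a pair give
-- 2(n - 3) distinct neighbours, and every neighbour arises this way because flips can be reversed.

module Submission where

open import Defs
open import Data.Nat using (ℕ; zero; suc; _≤_; _<_; _*_; _∸_; _+_; z≤n; s≤s; _<ᵇ_; _≟_)
open import Data.Nat.Properties
open import Data.Fin using (Fin; toℕ; fromℕ; fromℕ<) renaming (zero to fzero)
import Data.Fin as F
open import Data.Fin.Properties using (toℕ-injective; toℕ-fromℕ; toℕ-fromℕ<; toℕ<n)
open import Data.Vec using (lookup)
open import Data.Vec.Properties using (lookup∘tabulate; tabulate∘lookup; tabulate-cong)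
open import Data.Bool using (Bool; true; false; if_then_else_; _∧_) renaming (T to True)
open import Data.Bool.Properties using (¬-not) renaming (_≟_ to _≟ᵇ_)
open import Data.List using (List; []; _∷_; [_]; length; _++_; map; allFin)
open import Data.List.Properties using (length-++; length-map)
open import Data.List.Membership.Propositional using (_∈_)
open import Data.List.Membership.Propositional.Properties
  using (∈-allFin; ∈-++⁻; ∈-++⁺ˡ; ∈-++⁺ʳ; ∈-map⁺; ∈-map⁻)
import Data.List.Relation.Unary.All as All
open import Data.List.Relation.Unary.All.Properties using () renaming (map⁺ to All-map⁺)
open import Data.List.Relation.Unary.Any using (here; there)
open import Data.List.Relation.Unary.AllPairs using ([]; _∷_)
open import Data.List.Relation.Unary.Unique.Propositional using (Unique)
open import Data.List.Relation.Unary.Unique.Propositional.Properties using (++⁺)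
open import Data.Product using (Σ; ∃; ∃-syntax; _×_; _,_; proj₁; proj₂)
open import Data.Sum using (_⊎_; inj₁; inj₂)
open import Data.Empty using (⊥; ⊥-elim)
open import Function.Base using (_∘′_)
open import Function.Bundles using (_⇔_; mk⇔)
open import Relation.Nullary using (¬_; Dec; yes; no; contradiction)
open import Relation.Nullary.Decidable using (⌊_⌋; _×-dec_; _⊎-dec_)
open import Relation.Binary.Definitions using (tri<; tri≈; tri>)
open import Relation.Binary.PropositionalEquality
  using (_≡_; _≢_; refl; sym; trans; cong; cong₂; subst; module ≡-Reasoning)

⟦_⟧ : ∀ {n} → Fin n → ℕ
⟦ x ⟧ = toℕ x

module _ {n : ℕ} where

  entry : DSet n → Fin n → Fin n → Bool
  entry S i j = lookup (lookup S i) j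

  sameEntry? : (i j a b : Fin n) → Dec (i ≡ a × j ≡ b)
  sameEntry? i j a b = (i F.≟ a) ×-dec (j F.≟ b)

  mem? : (S : DSet n) (i j : Fin n) → Dec (mem S i j)
  mem? S i j = entry S i j ≟ᵇ true

  entry-setAt : ∀ S a b v i j →
    entry (setAt S a b v) i j ≡ (if ⌊ i F.≟ a ⌋ ∧ ⌊ j F.≟ b ⌋ then v else entry S i j)
  entry-setAt S a b v i j =
    trans (cong (λ r → lookup r j) (lookup∘tabulate _ i)) (lookup∘tabulate _ j)

  entry-setAt-same : ∀ S a b v → entry (setAt S a b v) a b ≡ v
  entry-setAt-same S a b v rewrite entry-setAt S a b v a b with a F.≟ a | b F.≟ b
  ... | yes _ | yes _ = refl
  ... | no a≢a | _ = contradiction refl a≢a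
  ... | yes _ | no b≢b = contradiction refl b≢b

  entry-setAt-other : ∀ S a b v i j → ¬ (i ≡ a × j ≡ b) → entry (setAt S a b v) i j ≡ entry S i j
  entry-setAt-other S a b v i j ¬ij rewrite entry-setAt S a b v i j with i F.≟ a | j F.≟ b
  ... | yes i=a | yes j=b = contradiction (i=a , j=b) ¬ij
  ... | yes _ | no _ = refl
  ... | no _ | _ = refl

  DSet-ext : ∀ {S S′} → (∀ i j → entry S i j ≡ entry S′ i j) → S ≡ S′
  DSet-ext {S} {S′} eq = begin
    S                                              ≡⟨ tabulate∘lookup S ⟨
    Data.Vec.tabulate (λ i → lookup S i)           ≡⟨ tabulate-cong row ⟩
    Data.Vec.tabulate (λ i → lookup S′ i)          ≡⟨ tabulate∘lookup S′ ⟩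
    S′                                             ∎
    where
    open ≡-Reasoning
    row : ∀ i → lookup S i ≡ lookup S′ i
    row i = trans (sym (tabulate∘lookup (lookup S i)))
                  (trans (tabulate-cong (eq i)) (tabulate∘lookup (lookup S′ i)))

  mem-replace-new : ∀ T a b c d → mem (replace T a b (c , d)) c d
  mem-replace-new T a b c d = entry-setAt-same (setAt T a b false) c d true

  entry-replace-old : ∀ T a b c d → ¬ (a ≡ c × b ≡ d) → entry (replace T a b (c , d)) a b ≡ false
  entry-replace-old T a b c d ¬ab=cd =
    trans (entry-setAt-other (setAt T a b false) c d true a b ¬ab=cd) (entry-setAt-same T a b false)

  entry-replace-other : ∀ T a b c d i j → ¬ (i ≡ a × j ≡ b) → ¬ (i ≡ c × j ≡ d) →
    entry (replace T a b (c , d)) i j ≡ entry T i j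
  entry-replace-other T a b c d i j ¬ab ¬cd =
    trans (entry-setAt-other (setAt T a b false) c d true i j ¬cd) (entry-setAt-other T a b false i j ¬ab)

  ¬mem-replace-old : ∀ T a b c d → ¬ (a ≡ c × b ≡ d) → ¬ mem (replace T a b (c , d)) a b
  ¬mem-replace-old T a b c d ¬ab=cd m with trans (sym (entry-replace-old T a b c d ¬ab=cd)) m
  ... | ()

  mem-replace⁻ : ∀ T a b c d i j → mem (replace T a b (c , d)) i j →
    (i ≡ c × j ≡ d) ⊎ (mem T i j × ¬ (i ≡ a × j ≡ b))
  mem-replace⁻ T a b c d i j m with sameEntry? i j c d | sameEntry? i j a b
  ... | yes ij=cd | _ = inj₁ ij=cd
  ... | no ¬ij=cd | yes (refl , refl) = contradiction m (¬mem-replace-old T a b c d ¬ij=cd)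
  ... | no ¬ij=cd | no ¬ij=ab = inj₂ (trans (sym (entry-replace-other T a b c d i j ¬ij=ab ¬ij=cd)) m , ¬ij=ab)

  mem-replace⁺ : ∀ T a b c d i j → mem T i j → ¬ (i ≡ a × j ≡ b) → mem (replace T a b (c , d)) i j
  mem-replace⁺ T a b c d i j m ¬ij=ab with sameEntry? i j c d
  ... | yes (refl , refl) = mem-replace-new T a b i j
  ... | no ¬ij=cd = trans (entry-replace-other T a b c d i j ¬ij=ab ¬ij=cd) m

  replace-replace : ∀ T a b c d → mem T a b → ¬ mem T c d → ¬ (c ≡ a × d ≡ b) →
    replace (replace T a b (c , d)) c d (a , b) ≡ T
  replace-replace T a b c d mab ¬mcd ¬cd=ab = DSet-ext pointwise
    where
    pointwise : ∀ i j → entry (replace (replace T a b (c , d)) c d (a , b)) i j ≡ entry T i j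
    pointwise i j with sameEntry? i j a b | sameEntry? i j c d
    ... | yes (refl , refl) | _ = trans (mem-replace-new (replace T i j (c , d)) c d i j) (sym mab)
    ... | no _ | yes (refl , refl) =
      trans (entry-replace-old (replace T a b (i , j)) i j a b ¬cd=ab) (sym (¬-not ¬mcd))
    ... | no ¬ij=ab | no ¬ij=cd =
      trans (entry-replace-other (replace T a b (c , d)) c d a b i j ¬ij=cd ¬ij=ab)
            (entry-replace-other T a b c d i j ¬ij=ab ¬ij=cd)

  Bound-replace⁺ : ∀ T a b c d x y → Bound T x y → ¬ (x ≡ a × y ≡ b) → ¬ (y ≡ a × x ≡ b) →
    Bound (replace T a b (c , d)) x y
  Bound-replace⁺ T a b c d x y (inj₁ s) _ _ = inj₁ s
  Bound-replace⁺ T a b c d x y (inj₂ (inj₁ m)) ¬xy _ = inj₂ (inj₁ (mem-replace⁺ T a b c d x y m ¬xy))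
  Bound-replace⁺ T a b c d x y (inj₂ (inj₂ m)) _ ¬yx = inj₂ (inj₂ (mem-replace⁺ T a b c d y x m ¬yx))

no-vertex-between : ∀ {u v z} → u < z → z < v → suc u ≢ v
no-vertex-between u<z z<v refl = <⇒≱ u<z (≤-pred z<v)

<⇒≢ᶠ : ∀ {n} {x y : Fin n} → ⟦ x ⟧ < ⟦ y ⟧ → x ≢ y
<⇒≢ᶠ x<y refl = <-irrefl refl x<y

module _ {n : ℕ} where

  Crosses-sym : ∀ {a b c d : Fin n} → Crosses a b c d → Crosses c d a b
  Crosses-sym (inj₁ order) = inj₂ order
  Crosses-sym (inj₂ order) = inj₁ order

  Side-sym : ∀ {x y : Fin n} → Side x y → Side y x
  Side-sym (inj₁ e) = inj₂ (inj₁ e)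
  Side-sym (inj₂ (inj₁ e)) = inj₁ e
  Side-sym (inj₂ (inj₂ (inj₁ e))) = inj₂ (inj₂ (inj₂ e))
  Side-sym (inj₂ (inj₂ (inj₂ e))) = inj₂ (inj₂ (inj₁ e))

  Bound-sym : ∀ {S : DSet n} {x y : Fin n} → Bound S x y → Bound S y x
  Bound-sym (inj₁ s) = inj₁ (Side-sym s)
  Bound-sym (inj₂ (inj₁ m)) = inj₂ (inj₂ m)
  Bound-sym (inj₂ (inj₂ m)) = inj₂ (inj₁ m)

  Side? : (x y : Fin n) → Dec (Side x y)
  Side? x y = (suc ⟦ x ⟧ ≟ ⟦ y ⟧) ⊎-dec (suc ⟦ y ⟧ ≟ ⟦ x ⟧) ⊎-dec
    ((⟦ x ⟧ ≟ 0) ×-dec (suc ⟦ y ⟧ ≟ n)) ⊎-dec ((⟦ y ⟧ ≟ 0) ×-dec (suc ⟦ x ⟧ ≟ n))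

  Bound? : (S : DSet n) (x y : Fin n) → Dec (Bound S x y)
  Bound? S x y = Side? x y ⊎-dec (mem? S x y ⊎-dec mem? S y x)

  Wrap : Fin n → Fin n → Set
  Wrap x y = ⟦ x ⟧ ≡ 0 × suc ⟦ y ⟧ ≡ n

  <⇒¬Wrapʳ : ∀ {u v z : Fin n} → ⟦ v ⟧ < ⟦ z ⟧ → ¬ Wrap u v
  <⇒¬Wrapʳ {z = z} v<z (_ , v+1≡n) = <-irrefl refl (<-≤-trans (toℕ<n z) (subst (_≤ ⟦ z ⟧) v+1≡n v<z))

  <⇒¬Wrapˡ : ∀ {u v z : Fin n} → ⟦ z ⟧ < ⟦ u ⟧ → ¬ Wrap u v
  <⇒¬Wrapˡ z<u (u≡0 , _) = n≮0 (subst (_ <_) u≡0 z<u)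

  Side-cases : ∀ {u v : Fin n} → ⟦ u ⟧ < ⟦ v ⟧ → Side u v → (suc ⟦ u ⟧ ≡ ⟦ v ⟧) ⊎ Wrap u v
  Side-cases u<v (inj₁ e) = inj₁ e
  Side-cases u<v (inj₂ (inj₁ e)) = contradiction (subst (_ <_) e (n<1+n _)) (<-asym u<v)
  Side-cases u<v (inj₂ (inj₂ (inj₁ w))) = inj₂ w
  Side-cases u<v (inj₂ (inj₂ (inj₂ (v≡0 , _)))) = contradiction (subst (_ <_) v≡0 u<v) n≮0

  Bound< : DSet n → Fin n → Fin n → Set
  Bound< S x y = (suc ⟦ x ⟧ ≡ ⟦ y ⟧) ⊎ mem S x y ⊎ Wrap x y

  Bound<⇒mem : ∀ {S} {u v : Fin n} → Bound< S u v → suc ⟦ u ⟧ ≢ ⟦ v ⟧ → ¬ Wrap u v → mem S u v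
  Bound<⇒mem (inj₁ e) ¬consecutive _ = contradiction e ¬consecutive
  Bound<⇒mem (inj₂ (inj₁ m)) _ _ = m
  Bound<⇒mem (inj₂ (inj₂ w)) _ ¬wrap = contradiction w ¬wrap

  norm-< : ∀ (x y : Fin n) → ⟦ x ⟧ < ⟦ y ⟧ → norm x y ≡ (x , y)
  norm-< x y x<y with ⟦ x ⟧ <ᵇ ⟦ y ⟧ in eq
  ... | true = refl
  ... | false = ⊥-elim (subst True eq (<⇒<ᵇ x<y))

  norm-> : ∀ (x y : Fin n) → ⟦ y ⟧ < ⟦ x ⟧ → norm x y ≡ (y , x)
  norm-> x y y<x with ⟦ x ⟧ <ᵇ ⟦ y ⟧ in eq
  ... | true = contradiction (<ᵇ⇒< ⟦ x ⟧ ⟦ y ⟧ (subst True (sym eq) _)) (<-asym y<x)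
  ... | false = refl

  norm-cases : ∀ {x y u v : Fin n} → norm x y ≡ (u , v) → (x ≡ u × y ≡ v) ⊎ (x ≡ v × y ≡ u)
  norm-cases {x} {y} e with ⟦ x ⟧ <ᵇ ⟦ y ⟧
  norm-cases refl | true = inj₁ (refl , refl)
  norm-cases refl | false = inj₂ (refl , refl)

-- Triangulations

record Greatest {n} (P : Fin n → Set) : Set where
  field
    elem : Fin n
    satisfies : P elem
    maximal : ∀ y → P y → ⟦ y ⟧ ≤ ⟦ elem ⟧

greatest : ∀ {n} (P : Fin n → Set) → (∀ x → Dec (P x)) → ∀ {w} → P w → Greatest P
greatest {n} P P? {w} Pw = record { elem = proj₁ g ; satisfies = proj₁ (proj₂ g)
                                  ; maximal = λ y → proj₂ (proj₂ g) y (∈-allFin y) }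
  where
  greatest-in : (xs : List (Fin n)) → Σ (Fin n) λ m → P m × (∀ y → y ∈ xs → P y → ⟦ y ⟧ ≤ ⟦ m ⟧)
  greatest-in [] = w , Pw , λ _ ()
  greatest-in (x ∷ xs) with greatest-in xs | P? x
  ... | m , Pm , max | no ¬Px = m , Pm , λ { y (here refl) Py → contradiction Py ¬Px ; y (there y∈) → max y y∈ }
  ... | m , Pm , max | yes Px with ⟦ x ⟧ ≤? ⟦ m ⟧
  ...   | yes x≤m = m , Pm , λ { y (here refl) _ → x≤m ; y (there y∈) → max y y∈ }
  ...   | no x≰m = x , Px , λ { y (here refl) _ → ≤-refl
                              ; y (there y∈) Py → ≤-trans (max y y∈ Py) (<⇒≤ (≰⇒> x≰m)) }
  g : Σ (Fin n) λ m → P m × (∀ y → y ∈ allFin n → P y → ⟦ y ⟧ ≤ ⟦ m ⟧)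
  g = greatest-in (allFin n)

∸-split : ∀ p r q → p ≤ r → r ≤ q → (r ∸ p) + (q ∸ r) ≡ q ∸ p
∸-split zero r q z≤n r≤q = m+[n∸m]≡n r≤q
∸-split (suc p) (suc r) (suc q) (s≤s p≤r) (s≤s r≤q) = ∸-split p r q p≤r r≤q

pred+pred : ∀ i j → 1 ≤ i → 1 ≤ j → (i ∸ 1) + (j ∸ 1) ≡ (i + j) ∸ 2
pred+pred (suc i) (suc j) _ _ = sym (cong (_∸ 1) (+-suc i j))

record OrderedQuad {n} (S : DSet n) (w₀ w₁ w₂ w₃ : Fin n) : Set where
  field
    w₀<w₁ : ⟦ w₀ ⟧ < ⟦ w₁ ⟧
    w₁<w₂ : ⟦ w₁ ⟧ < ⟦ w₂ ⟧
    w₂<w₃ : ⟦ w₂ ⟧ < ⟦ w₃ ⟧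
    side₀₁ : Bound S w₀ w₁
    side₁₂ : Bound S w₁ w₂
    side₂₃ : Bound S w₂ w₃
    side₀₃ : Bound S w₀ w₃

Quad⇒OrderedQuad : ∀ {n} {S : DSet n} {a b a′ b′} → Quad S a b a′ b′ →
  (⟦ b ⟧ < ⟦ b′ ⟧ × OrderedQuad S a a′ b b′) ⊎ (⟦ b′ ⟧ < ⟦ a ⟧ × OrderedQuad S b′ a a′ b)
Quad⇒OrderedQuad {S = S} ((a<a′ , a′<b) , inj₁ b<b′ , a-a′ , a′-b , b-b′ , b′-a) = inj₁ (b<b′ , record
  { w₀<w₁ = a<a′ ; w₁<w₂ = a′<b ; w₂<w₃ = b<b′
  ; side₀₁ = a-a′ ; side₁₂ = a′-b ; side₂₃ = b-b′ ; side₀₃ = Bound-sym {S = S} b′-a })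
Quad⇒OrderedQuad {S = S} ((a<a′ , a′<b) , inj₂ b′<a , a-a′ , a′-b , b-b′ , b′-a) = inj₂ (b′<a , record
  { w₀<w₁ = b′<a ; w₁<w₂ = a<a′ ; w₂<w₃ = a′<b
  ; side₀₁ = b′-a ; side₁₂ = a-a′ ; side₂₃ = a′-b ; side₀₃ = Bound-sym {S = S} b-b′ })

module OrderedQuadrilateral {n} {S : DSet n} {w₀ w₁ w₂ w₃ : Fin n} (Q : OrderedQuad S w₀ w₁ w₂ w₃) where
  open OrderedQuad Q public

  w₀<w₂ : ⟦ w₀ ⟧ < ⟦ w₂ ⟧
  w₀<w₂ = <-trans w₀<w₁ w₁<w₂

  w₁<w₃ : ⟦ w₁ ⟧ < ⟦ w₃ ⟧
  w₁<w₃ = <-trans w₁<w₂ w₂<w₃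

  quad₀₂ : Quad S w₀ w₂ w₁ w₃
  quad₀₂ = (w₀<w₁ , w₁<w₂) , inj₁ w₂<w₃ , side₀₁ , side₁₂ , side₂₃ , Bound-sym {S = S} side₀₃

  quad₁₃ : Quad S w₁ w₃ w₂ w₀
  quad₁₃ = (w₁<w₂ , w₂<w₃) , inj₂ w₀<w₁ , side₁₂ , side₂₃ , Bound-sym {S = S} side₀₃ , side₀₁

  data QuadSide : Fin n → Fin n → Set where
    s₀₁ : QuadSide w₀ w₁
    s₁₂ : QuadSide w₁ w₂
    s₂₃ : QuadSide w₂ w₃
    s₀₃ : QuadSide w₀ w₃

  data QuadDiagonal : Fin n → Fin n → Set where
    d₀₂ : QuadDiagonal w₀ w₂
    d₁₃ : QuadDiagonal w₁ w₃

  QuadSide⇒< : ∀ {u v} → QuadSide u v → ⟦ u ⟧ < ⟦ v ⟧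
  QuadSide⇒< s₀₁ = w₀<w₁
  QuadSide⇒< s₁₂ = w₁<w₂
  QuadSide⇒< s₂₃ = w₂<w₃
  QuadSide⇒< s₀₃ = <-trans w₀<w₁ w₁<w₃

  QuadSide⇒Bound : ∀ {u v} → QuadSide u v → Bound S u v
  QuadSide⇒Bound s₀₁ = side₀₁
  QuadSide⇒Bound s₁₂ = side₁₂
  QuadSide⇒Bound s₂₃ = side₂₃
  QuadSide⇒Bound s₀₃ = side₀₃

  QuadDiagonal⇒< : ∀ {a b} → QuadDiagonal a b → ⟦ a ⟧ < ⟦ b ⟧
  QuadDiagonal⇒< d₀₂ = w₀<w₂
  QuadDiagonal⇒< d₁₃ = w₁<w₃

  side≢diagonal : ∀ {u v a b} → QuadSide u v → QuadDiagonal a b → ¬ (u ≡ a × v ≡ b)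
  side≢diagonal s₀₁ d₀₂ (_ , w₁≡w₂) = <⇒≢ᶠ w₁<w₂ w₁≡w₂
  side≢diagonal s₀₁ d₁₃ (w₀≡w₁ , _) = <⇒≢ᶠ w₀<w₁ w₀≡w₁
  side≢diagonal s₁₂ d₀₂ (w₁≡w₀ , _) = <⇒≢ᶠ w₀<w₁ (sym w₁≡w₀)
  side≢diagonal s₁₂ d₁₃ (_ , w₂≡w₃) = <⇒≢ᶠ w₂<w₃ w₂≡w₃
  side≢diagonal s₂₃ d₀₂ (w₂≡w₀ , _) = <⇒≢ᶠ w₀<w₂ (sym w₂≡w₀)
  side≢diagonal s₂₃ d₁₃ (w₂≡w₁ , _) = <⇒≢ᶠ w₁<w₂ (sym w₂≡w₁)
  side≢diagonal s₀₃ d₀₂ (_ , w₃≡w₂) = <⇒≢ᶠ w₂<w₃ (sym w₃≡w₂)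
  side≢diagonal s₀₃ d₁₃ (w₀≡w₁ , _) = <⇒≢ᶠ w₀<w₁ w₀≡w₁

  replace-diagonal : ∀ {a b} → QuadDiagonal a b → ∀ c d → OrderedQuad (replace S a b (c , d)) w₀ w₁ w₂ w₃
  replace-diagonal {a} {b} diag c d = record
    { w₀<w₁ = w₀<w₁ ; w₁<w₂ = w₁<w₂ ; w₂<w₃ = w₂<w₃
    ; side₀₁ = kept s₀₁ ; side₁₂ = kept s₁₂ ; side₂₃ = kept s₂₃ ; side₀₃ = kept s₀₃ }
    where
    kept : ∀ {u v} → QuadSide u v → Bound (replace S a b (c , d)) u v
    kept {u} {v} s = Bound-replace⁺ S a b c d u v (QuadSide⇒Bound s) (side≢diagonal s diag)
      λ { (refl , refl) → <-asym (QuadSide⇒< s) (QuadDiagonal⇒< diag) }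

module Triangulation {n : ℕ} (T : DSet n) (tri : IsTriangulation T) where

  mem⇒< : ∀ {a b} → mem T a b → ⟦ a ⟧ < ⟦ b ⟧
  mem⇒< {a} {b} m = proj₁ (proj₁ tri a b m)

  mem⇒IsDiag : ∀ {a b} → mem T a b → IsDiag a b
  mem⇒IsDiag {a} {b} m = proj₂ (proj₁ tri a b m)

  noncrossing : ∀ {a b c d} → mem T a b → mem T c d → ¬ Crosses a b c d
  noncrossing {a} {b} {c} {d} = proj₁ (proj₂ tri) a b c d

  maximal : ∀ {c d} → ⟦ c ⟧ < ⟦ d ⟧ → IsDiag c d → ¬ mem T c d →
    ∃[ a ] ∃[ b ] (mem T a b × Crosses a b c d)
  maximal {c} {d} = proj₂ (proj₂ tri) c d

  Bound⇒Bound< : ∀ {x y} → ⟦ x ⟧ < ⟦ y ⟧ → Bound T x y → Bound< T x y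
  Bound⇒Bound< x<y (inj₁ s) with Side-cases x<y s
  ... | inj₁ e = inj₁ e
  ... | inj₂ w = inj₂ (inj₂ w)
  Bound⇒Bound< x<y (inj₂ (inj₁ m)) = inj₂ (inj₁ m)
  Bound⇒Bound< x<y (inj₂ (inj₂ m)) = contradiction (mem⇒< m) (<-asym x<y)

  Uncrossed : Fin n → Fin n → Set
  Uncrossed p q = ∀ {x y} → mem T x y → ¬ Crosses p q x y

  Bound<⇒Uncrossed : ∀ {p q} → Bound< T p q → Uncrossed p q
  Bound<⇒Uncrossed (inj₁ e) _ (inj₁ (p<x , x<q , _)) = no-vertex-between p<x x<q e
  Bound<⇒Uncrossed (inj₁ e) _ (inj₂ (_ , p<y , y<q)) = no-vertex-between p<y y<q e
  Bound<⇒Uncrossed (inj₂ (inj₁ mpq)) m c = noncrossing mpq m c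
  Bound<⇒Uncrossed (inj₂ (inj₂ w)) {y = y} _ (inj₁ (_ , _ , q<y)) = <⇒¬Wrapʳ {z = y} q<y w
  Bound<⇒Uncrossed (inj₂ (inj₂ w)) {x = x} _ (inj₂ (x<p , _ , _)) = <⇒¬Wrapˡ {z = x} x<p w

  record InnerApex (p q : Fin n) : Set where
    field
      apex : Fin n
      p<apex : ⟦ p ⟧ < ⟦ apex ⟧
      apex<q : ⟦ apex ⟧ < ⟦ q ⟧
      p-apex : Bound T p apex
      apex-q : Bound T apex q

  -- The apex is the last vertex before q joined to p; maximality forces it to be joined to q.
  innerApex : ∀ p q → suc ⟦ p ⟧ < ⟦ q ⟧ → Uncrossed p q → InnerApex p q
  innerApex p q p+1<q unc = record
    { apex = m ; p<apex = p<m ; apex<q = m<q ; p-apex = p-m ; apex-q = m-q }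
    where
    Candidate : Fin n → Set
    Candidate x = ⟦ p ⟧ < ⟦ x ⟧ × ⟦ x ⟧ < ⟦ q ⟧ × Bound T p x
    p+1 : Fin n
    p+1 = fromℕ< (<-trans p+1<q (toℕ<n q))
    ⟦p+1⟧ : ⟦ p+1 ⟧ ≡ suc ⟦ p ⟧
    ⟦p+1⟧ = toℕ-fromℕ< (<-trans p+1<q (toℕ<n q))
    candidate-p+1 : Candidate p+1
    candidate-p+1 = subst (⟦ p ⟧ <_) (sym ⟦p+1⟧) (n<1+n _) , subst (_< ⟦ q ⟧) (sym ⟦p+1⟧) p+1<q ,
                    inj₁ (inj₁ (sym ⟦p+1⟧))
    open Greatest (greatest Candidate (λ x → (⟦ p ⟧ <? ⟦ x ⟧) ×-dec (⟦ x ⟧ <? ⟦ q ⟧) ×-dec Bound? T p x)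
                            candidate-p+1)
      renaming (elem to m; maximal to m-greatest)
    p<m : ⟦ p ⟧ < ⟦ m ⟧
    p<m = proj₁ satisfies
    m<q : ⟦ m ⟧ < ⟦ q ⟧
    m<q = proj₁ (proj₂ satisfies)
    p-m : Bound T p m
    p-m = proj₂ (proj₂ satisfies)
    ¬crossing : ∀ {x y} → mem T x y → ¬ Crosses x y m q
    ¬crossing mxy (inj₂ (x<m , m<x , q<y)) = unc mxy (inj₁ (<-trans p<m x<m , m<x , q<y))
    ¬crossing {x} {y} mxy (inj₁ (x<m , m<y , y<q)) with <-cmp ⟦ x ⟧ ⟦ p ⟧
    ... | tri< x<p _ _ = unc mxy (inj₂ (x<p , <-trans p<m m<y , y<q))
    ... | tri≈ _ x≡p _ with toℕ-injective x≡p
    ...   | refl = <⇒≱ m<y (m-greatest y (<-trans p<m m<y , y<q , inj₂ (inj₁ mxy)))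
    ¬crossing {x} {y} mxy (inj₁ (x<m , m<y , y<q)) | tri> _ _ p<x =
      Bound<⇒Uncrossed (Bound⇒Bound< p<m p-m) mxy (inj₁ (p<x , x<m , m<y))
    m-q : Bound T m q
    m-q with suc ⟦ m ⟧ ≟ ⟦ q ⟧ | mem? T m q
    ... | yes e | _ = inj₁ (inj₁ e)
    ... | no _ | yes mmq = inj₂ (inj₁ mmq)
    ... | no m+1≢q | no ¬mmq =
      let x , y , mxy , c = maximal m<q (≤∧≢⇒< m<q m+1≢q , inj₁ (≤-<-trans z≤n p<m)) ¬mmq
      in ⊥-elim (¬crossing mxy c)

  Within : (p q a b : Fin n) → Set
  Within p q a b = ⟦ p ⟧ ≤ ⟦ a ⟧ × ⟦ b ⟧ ≤ ⟦ q ⟧ × ¬ (a ≡ p × b ≡ q)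

  Outside : Fin n → Fin n → Fin n → Set
  Outside a b x = ⟦ b ⟧ < ⟦ x ⟧ ⊎ ⟦ x ⟧ < ⟦ a ⟧

  OuterApex : Fin n → Fin n → Set
  OuterApex a b = ∃[ b′ ] (Outside a b b′ × Bound T b b′ × Bound T b′ a)

  record Region (p q : Fin n) : Set where
    field
      diagonals : List (Fin n × Fin n)
      length-diagonals : length diagonals ≡ (⟦ q ⟧ ∸ ⟦ p ⟧) ∸ 2
      unique : Unique diagonals
      ∈⁻ : ∀ {a b} → (a , b) ∈ diagonals → mem T a b × Within p q a b
      ∈⁺ : ∀ {a b} → mem T a b → Within p q a b → (a , b) ∈ diagonals
      outer : ∀ {a b} → mem T a b → Within p q a b → OuterApex a b

  record ClosedRegion (p q : Fin n) : Set where
    field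
      diagonals : List (Fin n × Fin n)
      length-diagonals : length diagonals ≡ (⟦ q ⟧ ∸ ⟦ p ⟧) ∸ 1
      unique : Unique diagonals
      ∈⁻ : ∀ {a b} → (a , b) ∈ diagonals → mem T a b × ⟦ p ⟧ ≤ ⟦ a ⟧ × ⟦ b ⟧ ≤ ⟦ q ⟧
      ∈⁺ : ∀ {a b} → mem T a b → ⟦ p ⟧ ≤ ⟦ a ⟧ → ⟦ b ⟧ ≤ ⟦ q ⟧ → (a , b) ∈ diagonals

  chord : Fin n → Fin n → List (Fin n × Fin n)
  chord x y with mem? T x y
  ... | yes _ = [ (x , y) ]
  ... | no _ = []

  ∈-chord⁻ : ∀ {x y a b} → (a , b) ∈ chord x y → a ≡ x × b ≡ y × mem T x y
  ∈-chord⁻ {x} {y} with mem? T x y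
  ... | yes m = λ { (here refl) → refl , refl , m }
  ... | no _ = λ ()

  ∈-chord⁺ : ∀ {x y} → mem T x y → (x , y) ∈ chord x y
  ∈-chord⁺ {x} {y} m with mem? T x y
  ... | yes _ = here refl
  ... | no ¬m = contradiction m ¬m

  chord-unique : ∀ x y → Unique (chord x y)
  chord-unique x y with mem? T x y
  ... | yes _ = All.[] ∷ []
  ... | no _ = []

  length-chord : ∀ {x y} → Bound< T x y → ¬ Wrap x y →
    length (chord x y) + ((⟦ y ⟧ ∸ ⟦ x ⟧) ∸ 2) ≡ (⟦ y ⟧ ∸ ⟦ x ⟧) ∸ 1
  length-chord {x} {y} x-y ¬wrap with mem? T x y
  ... | yes m = sym (+-∸-assoc 1 (m+n≤o⇒m≤o∸n 2 (proj₁ (mem⇒IsDiag m))))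
  ... | no ¬m with x-y
  ...   | inj₁ e rewrite sym e | m+n∸n≡m 1 ⟦ x ⟧ = refl
  ...   | inj₂ (inj₁ m) = contradiction m ¬m
  ...   | inj₂ (inj₂ w) = contradiction w ¬wrap

  close : ∀ {p q} → Region p q → Bound< T p q → ¬ Wrap p q → ClosedRegion p q
  close {p} {q} R p-q ¬wrap = record
    { diagonals = R.diagonals ++ chord p q
    ; length-diagonals = begin
        length (R.diagonals ++ chord p q)            ≡⟨ length-++ R.diagonals ⟩
        length R.diagonals + length (chord p q)      ≡⟨ +-comm _ (length (chord p q)) ⟩
        length (chord p q) + length R.diagonals      ≡⟨ cong (length (chord p q) +_) R.length-diagonals ⟩
        length (chord p q) + ((⟦ q ⟧ ∸ ⟦ p ⟧) ∸ 2)   ≡⟨ length-chord p-q ¬wrap ⟩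
        (⟦ q ⟧ ∸ ⟦ p ⟧) ∸ 1                          ∎
    ; unique = ++⁺ R.unique (chord-unique p q) disjoint
    ; ∈⁻ = ∈⁻
    ; ∈⁺ = ∈⁺
    }
    where
    open ≡-Reasoning
    module R = Region R
    disjoint : ∀ {z} → ¬ (z ∈ R.diagonals × z ∈ chord p q)
    disjoint {a , b} (z∈R , z∈chord) with ∈-chord⁻ z∈chord
    ... | refl , refl , _ = proj₂ (proj₂ (proj₂ (R.∈⁻ z∈R))) (refl , refl)
    ∈⁻ : ∀ {a b} → (a , b) ∈ R.diagonals ++ chord p q → mem T a b × ⟦ p ⟧ ≤ ⟦ a ⟧ × ⟦ b ⟧ ≤ ⟦ q ⟧
    ∈⁻ z∈ with ∈-++⁻ R.diagonals z∈
    ... | inj₁ z∈R = let m , p≤a , b≤q , _ = R.∈⁻ z∈R in m , p≤a , b≤q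
    ... | inj₂ z∈chord with ∈-chord⁻ z∈chord
    ...   | refl , refl , m = m , ≤-refl , ≤-refl
    ∈⁺ : ∀ {a b} → mem T a b → ⟦ p ⟧ ≤ ⟦ a ⟧ → ⟦ b ⟧ ≤ ⟦ q ⟧ → (a , b) ∈ R.diagonals ++ chord p q
    ∈⁺ {a} {b} m p≤a b≤q with sameEntry? a b p q
    ... | yes (refl , refl) = ∈-++⁺ʳ R.diagonals (∈-chord⁺ m)
    ... | no ¬ab=pq = ∈-++⁺ˡ (R.∈⁺ m (p≤a , b≤q , ¬ab=pq))

  within-split : ∀ {p q r a b} → Uncrossed p r → Uncrossed r q → mem T a b → Within p q a b →
    ⟦ b ⟧ ≤ ⟦ r ⟧ ⊎ ⟦ r ⟧ ≤ ⟦ a ⟧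
  within-split {p} {q} {r} {a} {b} unc₁ unc₂ mab (p≤a , b≤q , ¬ab=pq) with ⟦ b ⟧ ≤? ⟦ r ⟧ | ⟦ r ⟧ ≤? ⟦ a ⟧
  ... | yes b≤r | _ = inj₁ b≤r
  ... | no _ | yes r≤a = inj₂ r≤a
  ... | no b≰r | no r≰a = ⊥-elim (straddles (≰⇒> r≰a) (≰⇒> b≰r))
    where
    straddles : ⟦ a ⟧ < ⟦ r ⟧ → ⟦ r ⟧ < ⟦ b ⟧ → ⊥
    straddles a<r r<b with m≤n⇒m<n∨m≡n p≤a | m≤n⇒m<n∨m≡n b≤q
    ... | inj₁ p<a | _ = unc₁ mab (inj₁ (p<a , a<r , r<b))
    ... | inj₂ _ | inj₁ b<q = unc₂ mab (inj₂ (a<r , r<b , b<q))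
    ... | inj₂ p≡a | inj₂ b≡q = ¬ab=pq (toℕ-injective (sym p≡a) , toℕ-injective b≡q)

  -- the diagonals inside the triangle (p , r , q) split into those below (p , r) and those below (r , q)
  module Join {p q r} (p<r : ⟦ p ⟧ < ⟦ r ⟧) (r<q : ⟦ r ⟧ < ⟦ q ⟧)
              (p-q : Bound T p q) (p-r : Bound T p r) (r-q : Bound T r q)
              (R₁ : Region p r) (R₂ : Region r q) where

    private
      p-r< : Bound< T p r
      p-r< = Bound⇒Bound< p<r p-r
      r-q< : Bound< T r q
      r-q< = Bound⇒Bound< r<q r-q
      module L = ClosedRegion (close R₁ p-r< (<⇒¬Wrapʳ {z = q} r<q))
      module R = ClosedRegion (close R₂ r-q< (<⇒¬Wrapˡ {z = p} p<r))
      split : ∀ {a b} → mem T a b → Within p q a b → ⟦ b ⟧ ≤ ⟦ r ⟧ ⊎ ⟦ r ⟧ ≤ ⟦ a ⟧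
      split = within-split (Bound<⇒Uncrossed p-r<) (Bound<⇒Uncrossed r-q<)
      open ≡-Reasoning

      length-joined : length (L.diagonals ++ R.diagonals) ≡ (⟦ q ⟧ ∸ ⟦ p ⟧) ∸ 2
      length-joined = begin
        length (L.diagonals ++ R.diagonals)
          ≡⟨ length-++ L.diagonals ⟩
        length L.diagonals + length R.diagonals
          ≡⟨ cong₂ _+_ L.length-diagonals R.length-diagonals ⟩
        ((⟦ r ⟧ ∸ ⟦ p ⟧) ∸ 1) + ((⟦ q ⟧ ∸ ⟦ r ⟧) ∸ 1)
          ≡⟨ pred+pred _ _ (m<n⇒0<n∸m p<r) (m<n⇒0<n∸m r<q) ⟩
        ((⟦ r ⟧ ∸ ⟦ p ⟧) + (⟦ q ⟧ ∸ ⟦ r ⟧)) ∸ 2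
          ≡⟨ cong (_∸ 2) (∸-split _ _ _ (<⇒≤ p<r) (<⇒≤ r<q)) ⟩
        (⟦ q ⟧ ∸ ⟦ p ⟧) ∸ 2
          ∎

      disjoint : ∀ {z} → ¬ (z ∈ L.diagonals × z ∈ R.diagonals)
      disjoint {a , b} (z∈L , z∈R) =
        let m , _ , b≤r = L.∈⁻ z∈L ; _ , r≤a , _ = R.∈⁻ z∈R
        in <⇒≱ (mem⇒< m) (≤-trans b≤r r≤a)

      ∈⁻ : ∀ {a b} → (a , b) ∈ L.diagonals ++ R.diagonals → mem T a b × Within p q a b
      ∈⁻ z∈ with ∈-++⁻ L.diagonals z∈
      ... | inj₁ z∈L = let m , p≤a , b≤r = L.∈⁻ z∈L
                       in m , p≤a , ≤-trans b≤r (<⇒≤ r<q) , λ { (_ , refl) → <⇒≱ r<q b≤r }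
      ... | inj₂ z∈R = let m , r≤a , b≤q = R.∈⁻ z∈R
                       in m , ≤-trans (<⇒≤ p<r) r≤a , b≤q , λ { (refl , _) → <⇒≱ p<r r≤a }

      ∈⁺ : ∀ {a b} → mem T a b → Within p q a b → (a , b) ∈ L.diagonals ++ R.diagonals
      ∈⁺ m w@(p≤a , b≤q , _) with split m w
      ... | inj₁ b≤r = ∈-++⁺ˡ (L.∈⁺ m p≤a b≤r)
      ... | inj₂ r≤a = ∈-++⁺ʳ L.diagonals (R.∈⁺ m r≤a b≤q)

      outer : ∀ {a b} → mem T a b → Within p q a b → OuterApex a b
      outer {a} {b} m w@(p≤a , b≤q , _) with split m w
      ... | inj₁ b≤r with sameEntry? a b p r
      ...   | yes (refl , refl) = q , inj₁ r<q , r-q , Bound-sym {S = T} p-q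
      ...   | no ¬ab=pr = Region.outer R₁ m (p≤a , b≤r , ¬ab=pr)
      outer {a} {b} m w@(p≤a , b≤q , _) | inj₂ r≤a with sameEntry? a b r q
      ...   | yes (refl , refl) = p , inj₂ p<r , Bound-sym {S = T} p-q , p-r
      ...   | no ¬ab=rq = Region.outer R₂ m (r≤a , b≤q , ¬ab=rq)

    region : Region p q
    region = record
      { diagonals = L.diagonals ++ R.diagonals
      ; length-diagonals = length-joined
      ; unique = ++⁺ L.unique R.unique disjoint
      ; ∈⁻ = ∈⁻
      ; ∈⁺ = ∈⁺
      ; outer = outer
      }

  side-region : ∀ {p q} → suc ⟦ p ⟧ ≡ ⟦ q ⟧ → Region p q
  side-region {p} {q} p+1≡q = record
    { diagonals = []
    ; length-diagonals = length-empty
    ; unique = []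
    ; ∈⁻ = λ ()
    ; ∈⁺ = λ m w → ⊥-elim (nothing-within m w)
    ; outer = λ m w → ⊥-elim (nothing-within m w)
    }
    where
    length-empty : 0 ≡ (⟦ q ⟧ ∸ ⟦ p ⟧) ∸ 2
    length-empty rewrite sym p+1≡q | m+n∸n≡m 1 ⟦ p ⟧ = refl
    nothing-within : ∀ {a b} → mem T a b → Within p q a b → ⊥
    nothing-within m (p≤a , b≤q , _) =
      <⇒≱ (≤-trans (s≤s (s≤s p≤a)) (proj₁ (mem⇒IsDiag m))) (subst (_ ≤_) (sym p+1≡q) b≤q)

  region : ∀ k p q → ⟦ q ⟧ ∸ ⟦ p ⟧ ≤ k → ⟦ p ⟧ < ⟦ q ⟧ → Bound T p q → Region p q
  region zero p q size p<q _ = contradiction size (<⇒≱ (m<n⇒0<n∸m p<q))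
  region (suc k) p q size p<q p-q with suc ⟦ p ⟧ ≟ ⟦ q ⟧
  ... | yes p+1≡q = side-region p+1≡q
  ... | no p+1≢q = Join.region p<r r<q p-q p-r r-q (region k p r size₁ p<r p-r) (region k r q size₂ r<q r-q)
    where
    open InnerApex (innerApex p q (≤∧≢⇒< p<q p+1≢q) (Bound<⇒Uncrossed (Bound⇒Bound< p<q p-q)))
      renaming (apex to r; p<apex to p<r; apex<q to r<q; p-apex to p-r; apex-q to r-q)
    size₁ : ⟦ r ⟧ ∸ ⟦ p ⟧ ≤ k
    size₁ = ≤-pred (≤-trans (∸-monoˡ-< r<q (<⇒≤ p<r)) size)
    size₂ : ⟦ q ⟧ ∸ ⟦ r ⟧ ≤ k
    size₂ = ≤-pred (≤-trans (∸-monoʳ-< p<r (<⇒≤ r<q)) size)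

  Bound⇒mem : ∀ {u v z : Fin n} → ⟦ u ⟧ < ⟦ z ⟧ → ⟦ z ⟧ < ⟦ v ⟧ → ¬ Wrap u v → Bound T u v → mem T u v
  Bound⇒mem u<z z<v ¬wrap u-v =
    Bound<⇒mem {S = T} (Bound⇒Bound< (<-trans u<z z<v) u-v) (no-vertex-between u<z z<v) ¬wrap

  ¬crossing-bounds : ∀ {a x y b : Fin n} → ⟦ a ⟧ < ⟦ x ⟧ → ⟦ x ⟧ < ⟦ y ⟧ → ⟦ y ⟧ < ⟦ b ⟧ →
    Bound T a y → Bound T x b → ⊥
  ¬crossing-bounds {a = a} {b = b} a<x x<y y<b a-y x-b =
    noncrossing (Bound⇒mem a<x x<y (<⇒¬Wrapʳ {z = b} y<b) a-y)
                (Bound⇒mem x<y y<b (<⇒¬Wrapˡ {z = a} a<x) x-b)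
                (inj₁ (a<x , x<y , y<b))

  private
    outer-ordered : ∀ {a b b₁ b₂} → ⟦ a ⟧ < ⟦ b ⟧ → ⟦ b₁ ⟧ < ⟦ b₂ ⟧ → Outside a b b₁ → Outside a b b₂ →
      Bound T b b₁ → Bound T b₁ a → Bound T b b₂ → Bound T b₂ a → ⊥
    outer-ordered a<b b₁<b₂ (inj₁ b<b₁) (inj₁ _) _ b₁-a b-b₂ _ =
      ¬crossing-bounds a<b b<b₁ b₁<b₂ (Bound-sym {S = T} b₁-a) b-b₂
    outer-ordered a<b b₁<b₂ (inj₁ b<b₁) (inj₂ b₂<a) _ _ _ _ =
      <-asym b₁<b₂ (<-trans b₂<a (<-trans a<b b<b₁))
    outer-ordered a<b b₁<b₂ (inj₂ b₁<a) (inj₁ b<b₂) b-b₁ _ _ b₂-a =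
      ¬crossing-bounds b₁<a a<b b<b₂ (Bound-sym {S = T} b-b₁) (Bound-sym {S = T} b₂-a)
    outer-ordered a<b b₁<b₂ (inj₂ b₁<a) (inj₂ b₂<a) _ b₁-a b-b₂ _ =
      ¬crossing-bounds b₁<b₂ b₂<a a<b b₁-a (Bound-sym {S = T} b-b₂)

  quad-unique : ∀ {a b a₁ b₁ a₂ b₂} → Quad T a b a₁ b₁ → Quad T a b a₂ b₂ → a₁ ≡ a₂ × b₁ ≡ b₂
  quad-unique {a} {b} {a₁} {b₁} {a₂} {b₂}
              ((a<a₁ , a₁<b) , o₁ , a-a₁ , a₁-b , b-b₁ , b₁-a)
              ((a<a₂ , a₂<b) , o₂ , a-a₂ , a₂-b , b-b₂ , b₂-a) =
    inner , outer
    where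
    a<b : ⟦ a ⟧ < ⟦ b ⟧
    a<b = <-trans a<a₁ a₁<b
    inner : a₁ ≡ a₂
    inner with <-cmp ⟦ a₁ ⟧ ⟦ a₂ ⟧
    ... | tri< a₁<a₂ _ _ = ⊥-elim (¬crossing-bounds a<a₁ a₁<a₂ a₂<b a-a₂ a₁-b)
    ... | tri≈ _ e _ = toℕ-injective e
    ... | tri> _ _ a₂<a₁ = ⊥-elim (¬crossing-bounds a<a₂ a₂<a₁ a₁<b a-a₁ a₂-b)
    outer : b₁ ≡ b₂
    outer with <-cmp ⟦ b₁ ⟧ ⟦ b₂ ⟧
    ... | tri< b₁<b₂ _ _ = ⊥-elim (outer-ordered a<b b₁<b₂ o₁ o₂ b-b₁ b₁-a b-b₂ b₂-a)
    ... | tri≈ _ e _ = toℕ-injective e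
    ... | tri> _ _ b₂<b₁ = ⊥-elim (outer-ordered a<b b₂<b₁ o₂ o₁ b-b₂ b₂-a b-b₁ b₁-a)

  flip-triangulation : ∀ {d₁ d₂ e₁ e₂} → mem T d₁ d₂ → ⟦ e₁ ⟧ < ⟦ e₂ ⟧ → IsDiag e₁ e₂ → Crosses d₁ d₂ e₁ e₂ →
    (∀ {x y} → mem T x y → ¬ (x ≡ d₁ × y ≡ d₂) → ¬ Crosses e₁ e₂ x y) →
    (∀ {x y} → Crosses d₁ d₂ x y → ¬ (x ≡ e₁ × y ≡ e₂) →
       ∃[ u ] ∃[ v ] (mem T u v × ¬ (u ≡ d₁ × v ≡ d₂) × Crosses u v x y)) →
    IsTriangulation (replace T d₁ d₂ (e₁ , e₂))
  flip-triangulation {d₁} {d₂} {e₁} {e₂} md e₁<e₂ e-diag d×e e-uncrossed d-crossed =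
    diagonals′ , noncrossing′ , maximal′
    where
    T′ : DSet n
    T′ = replace T d₁ d₂ (e₁ , e₂)
    keep : ∀ {x y} → mem T x y → ¬ (x ≡ d₁ × y ≡ d₂) → mem T′ x y
    keep {x} {y} = mem-replace⁺ T d₁ d₂ e₁ e₂ x y
    diagonals′ : ∀ a b → mem T′ a b → ⟦ a ⟧ < ⟦ b ⟧ × IsDiag a b
    diagonals′ a b m with mem-replace⁻ T d₁ d₂ e₁ e₂ a b m
    ... | inj₁ (refl , refl) = e₁<e₂ , e-diag
    ... | inj₂ (m′ , _) = proj₁ tri a b m′
    noncrossing′ : ∀ a b c d → mem T′ a b → mem T′ c d → ¬ Crosses a b c d
    noncrossing′ a b c d m₁ m₂ with mem-replace⁻ T d₁ d₂ e₁ e₂ a b m₁ | mem-replace⁻ T d₁ d₂ e₁ e₂ c d m₂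
    ... | inj₁ (refl , refl) | inj₁ (refl , refl) = λ { (inj₁ (a<a , _)) → <-irrefl refl a<a
                                                       ; (inj₂ (a<a , _)) → <-irrefl refl a<a }
    ... | inj₁ (refl , refl) | inj₂ (m₂′ , ¬cd) = e-uncrossed m₂′ ¬cd
    ... | inj₂ (m₁′ , ¬ab) | inj₁ (refl , refl) = e-uncrossed m₁′ ¬ab ∘′ Crosses-sym
    ... | inj₂ (m₁′ , _) | inj₂ (m₂′ , _) = noncrossing m₁′ m₂′
    maximal′ : ∀ c d → ⟦ c ⟧ < ⟦ d ⟧ → IsDiag c d → ¬ mem T′ c d → ∃[ a ] ∃[ b ] (mem T′ a b × Crosses a b c d)
    maximal′ c d c<d diag ¬m with sameEntry? c d d₁ d₂
    ... | yes (refl , refl) = e₁ , e₂ , mem-replace-new T c d e₁ e₂ , Crosses-sym d×e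
    ... | no ¬cd with maximal c<d diag (λ m → ¬m (keep m ¬cd))
    ...   | x , y , mxy , x×c with sameEntry? x y d₁ d₂
    ...     | no ¬xy = x , y , keep mxy ¬xy , x×c
    ...     | yes (refl , refl) =
      let u , v , muv , ¬uv , u×c = d-crossed x×c λ { (refl , refl) → ¬m (mem-replace-new T x y c d) }
      in u , v , keep muv ¬uv , u×c

  module QuadFlips {w₀ w₁ w₂ w₃} (Q : OrderedQuad T w₀ w₁ w₂ w₃) where
    open OrderedQuadrilateral Q

    SideCrossing : Fin n → Fin n → Set
    SideCrossing x y = ∃[ u ] ∃[ v ] (QuadSide u v × mem T u v × Crosses u v x y)

    -- A chord crossing one diagonal of the quadrilateral, other than the opposite diagonal,
    -- leaves the quadrilateral through a side.
    crossing₀₂ : ∀ {x y} → Crosses w₀ w₂ x y → ¬ (x ≡ w₁ × y ≡ w₃) → SideCrossing x y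
    crossing₀₂ {x} {y} (inj₁ (w₀<x , x<w₂ , w₂<y)) ¬13 with <-cmp ⟦ x ⟧ ⟦ w₁ ⟧
    ... | tri< x<w₁ _ _ = w₀ , w₁ , s₀₁ , Bound⇒mem w₀<x x<w₁ (<⇒¬Wrapʳ {z = y} (<-trans w₁<w₂ w₂<y)) side₀₁ ,
                          inj₁ (w₀<x , x<w₁ , <-trans w₁<w₂ w₂<y)
    ... | tri> _ _ w₁<x = w₁ , w₂ , s₁₂ , Bound⇒mem w₁<x x<w₂ (<⇒¬Wrapˡ {z = w₀} w₀<w₁) side₁₂ ,
                          inj₁ (w₁<x , x<w₂ , w₂<y)
    ... | tri≈ _ x≡w₁ _ with <-cmp ⟦ y ⟧ ⟦ w₃ ⟧
    ...   | tri< y<w₃ _ _ = w₂ , w₃ , s₂₃ , Bound⇒mem w₂<y y<w₃ (<⇒¬Wrapˡ {z = w₀} w₀<w₂) side₂₃ ,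
                            inj₂ (x<w₂ , w₂<y , y<w₃)
    ...   | tri≈ _ y≡w₃ _ = ⊥-elim (¬13 (toℕ-injective x≡w₁ , toℕ-injective y≡w₃))
    ...   | tri> _ _ w₃<y = w₀ , w₃ , s₀₃ , Bound⇒mem w₀<w₁ w₁<w₃ (<⇒¬Wrapʳ {z = y} w₃<y) side₀₃ ,
                            inj₁ (w₀<x , subst (_< ⟦ w₃ ⟧) (sym x≡w₁) w₁<w₃ , w₃<y)
    crossing₀₂ {x} {y} (inj₂ (x<w₀ , w₀<y , y<w₂)) _ with <-cmp ⟦ y ⟧ ⟦ w₁ ⟧
    ... | tri< y<w₁ _ _ = w₀ , w₁ , s₀₁ , Bound⇒mem w₀<y y<w₁ (<⇒¬Wrapʳ {z = w₂} w₁<w₂) side₀₁ ,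
                          inj₂ (x<w₀ , w₀<y , y<w₁)
    ... | tri≈ _ y≡w₁ _ = w₀ , w₃ , s₀₃ , Bound⇒mem w₀<w₁ w₁<w₃ (<⇒¬Wrapˡ {z = x} x<w₀) side₀₃ ,
                          inj₂ (x<w₀ , w₀<y , subst (_< ⟦ w₃ ⟧) (sym y≡w₁) w₁<w₃)
    ... | tri> _ _ w₁<y = w₁ , w₂ , s₁₂ , Bound⇒mem w₁<y y<w₂ (<⇒¬Wrapˡ {z = w₀} w₀<w₁) side₁₂ ,
                          inj₂ (<-trans x<w₀ w₀<w₁ , w₁<y , y<w₂)

    crossing₁₃ : ∀ {x y} → Crosses w₁ w₃ x y → ¬ (x ≡ w₀ × y ≡ w₂) → SideCrossing x y
    crossing₁₃ {x} {y} (inj₁ (w₁<x , x<w₃ , w₃<y)) _ with <-cmp ⟦ x ⟧ ⟦ w₂ ⟧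
    ... | tri< x<w₂ _ _ = w₁ , w₂ , s₁₂ , Bound⇒mem w₁<x x<w₂ (<⇒¬Wrapˡ {z = w₀} w₀<w₁) side₁₂ ,
                          inj₁ (w₁<x , x<w₂ , <-trans w₂<w₃ w₃<y)
    ... | tri≈ _ _ _ = w₀ , w₃ , s₀₃ , Bound⇒mem w₀<w₁ w₁<w₃ (<⇒¬Wrapʳ {z = y} w₃<y) side₀₃ ,
                       inj₁ (<-trans w₀<w₁ w₁<x , x<w₃ , w₃<y)
    ... | tri> _ _ w₂<x = w₂ , w₃ , s₂₃ , Bound⇒mem w₂<x x<w₃ (<⇒¬Wrapˡ {z = w₀} w₀<w₂) side₂₃ ,
                          inj₁ (w₂<x , x<w₃ , w₃<y)
    crossing₁₃ {x} {y} (inj₂ (x<w₁ , w₁<y , y<w₃)) ¬02 with <-cmp ⟦ y ⟧ ⟦ w₂ ⟧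
    ... | tri< y<w₂ _ _ = w₁ , w₂ , s₁₂ , Bound⇒mem w₁<y y<w₂ (<⇒¬Wrapˡ {z = w₀} w₀<w₁) side₁₂ ,
                          inj₂ (x<w₁ , w₁<y , y<w₂)
    ... | tri> _ _ w₂<y = w₂ , w₃ , s₂₃ , Bound⇒mem w₂<y y<w₃ (<⇒¬Wrapˡ {z = w₀} w₀<w₂) side₂₃ ,
                          inj₂ (<-trans x<w₁ w₁<w₂ , w₂<y , y<w₃)
    ... | tri≈ _ y≡w₂ _ with <-cmp ⟦ x ⟧ ⟦ w₀ ⟧
    ...   | tri< x<w₀ _ _ = w₀ , w₃ , s₀₃ , Bound⇒mem w₀<w₁ w₁<w₃ (<⇒¬Wrapˡ {z = x} x<w₀) side₀₃ ,
                            inj₂ (x<w₀ , <-trans w₀<w₁ w₁<y , y<w₃)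
    ...   | tri≈ _ x≡w₀ _ = ⊥-elim (¬02 (toℕ-injective x≡w₀ , toℕ-injective y≡w₂))
    ...   | tri> _ _ w₀<x = w₀ , w₁ , s₀₁ , Bound⇒mem w₀<x x<w₁ (<⇒¬Wrapʳ {z = w₂} w₁<w₂) side₀₁ ,
                            inj₁ (w₀<x , x<w₁ , w₁<y)

    flip₀₂ : mem T w₀ w₂ → IsTriangulation (replace T w₀ w₂ (w₁ , w₃))
    flip₀₂ m = flip-triangulation m w₁<w₃ (≤-trans (s≤s w₁<w₂) w₂<w₃ , inj₁ (≤-<-trans z≤n w₀<w₁))
      (inj₁ (w₀<w₁ , w₁<w₂ , w₂<w₃))
      (λ mxy ¬02 x×13 → let _ , _ , _ , muv , u×x = crossing₁₃ x×13 ¬02 in noncrossing muv mxy u×x)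
      (λ x×02 ¬13 → let u , v , s , muv , u×x = crossing₀₂ x×02 ¬13 in u , v , muv , side≢diagonal s d₀₂ , u×x)

    flip₁₃ : mem T w₁ w₃ → IsTriangulation (replace T w₁ w₃ (w₀ , w₂))
    flip₁₃ m = flip-triangulation m w₀<w₂ (≤-trans (s≤s w₀<w₁) w₁<w₂ , inj₂ (≤-trans (s≤s w₂<w₃) (toℕ<n w₃)))
      (inj₂ (w₀<w₁ , w₁<w₂ , w₂<w₃))
      (λ mxy ¬13 x×02 → let _ , _ , _ , muv , u×x = crossing₀₂ x×02 ¬13 in noncrossing muv mxy u×x)
      (λ x×13 ¬02 → let u , v , s , muv , u×x = crossing₁₃ x×13 ¬02 in u , v , muv , side≢diagonal s d₁₃ , u×x)

  record FlipFacts (a b c d : Fin n) (T′ : DSet n) : Set where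
    field
      triangulation : IsTriangulation T′
      crosses : Crosses a b c d
      ¬mem-new : ¬ mem T c d
      mem-new : mem T′ c d
      ¬mem-old : ¬ mem T′ a b
      reverse : FlipT T′ c d a b T

  flip-facts : ∀ {a b c d T′} → FlipT T a b c d T′ → FlipFacts a b c d T′
  flip-facts {a} {b} (mab , a′ , b′ , q@((a<a′ , a′<b) , _) , norm≡ , refl) with Quad⇒OrderedQuad q
  ... | inj₁ (b<b′ , Q) with trans (sym (norm-< a′ b′ (<-trans a′<b b<b′))) norm≡
  ...   | refl = record
    { triangulation = QuadFlips.flip₀₂ Q mab
    ; crosses = a×a′
    ; ¬mem-new = ¬new
    ; mem-new = mem-replace-new T a b a′ b′
    ; ¬mem-old = ¬mem-replace-old T a b a′ b′ λ (a≡a′ , _) → <⇒≢ᶠ a<a′ a≡a′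
    ; reverse = mem-replace-new T a b a′ b′ , b , a ,
                OrderedQuadrilateral.quad₁₃ (Q.replace-diagonal Q.d₀₂ a′ b′) ,
                norm-> b a (<-trans a<a′ a′<b) ,
                sym (replace-replace T a b a′ b′ mab ¬new λ (a′≡a , _) → <⇒≢ᶠ a<a′ (sym a′≡a))
    }
    where
    module Q = OrderedQuadrilateral Q
    a×a′ : Crosses a b a′ b′
    a×a′ = inj₁ (a<a′ , a′<b , b<b′)
    ¬new : ¬ mem T a′ b′
    ¬new m = noncrossing mab m a×a′
  flip-facts {a} {b} (mab , a′ , b′ , q@((a<a′ , a′<b) , _) , norm≡ , refl) | inj₂ (b′<a , Q)
    with trans (sym (norm-> a′ b′ (<-trans b′<a a<a′))) norm≡
  ... | refl = record
    { triangulation = QuadFlips.flip₁₃ Q mab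
    ; crosses = a×b′
    ; ¬mem-new = ¬new
    ; mem-new = mem-replace-new T a b b′ a′
    ; ¬mem-old = ¬mem-replace-old T a b b′ a′ λ (a≡b′ , _) → <⇒≢ᶠ b′<a (sym a≡b′)
    ; reverse = mem-replace-new T a b b′ a′ , a , b ,
                OrderedQuadrilateral.quad₀₂ (Q.replace-diagonal Q.d₁₃ b′ a′) ,
                norm-< a b (<-trans a<a′ a′<b) ,
                sym (replace-replace T a b b′ a′ mab ¬new λ (b′≡a , _) → <⇒≢ᶠ b′<a b′≡a)
    }
    where
    module Q = OrderedQuadrilateral Q
    a×b′ : Crosses a b b′ a′
    a×b′ = inj₂ (b′<a , a<a′ , a′<b)
    ¬new : ¬ mem T b′ a′
    ¬new m = noncrossing mab m a×b′

  flip-irreflexive : ∀ {a b c d} → ¬ FlipT T a b c d T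
  flip-irreflexive f = FlipFacts.¬mem-old (flip-facts f) (proj₁ f)

  flip-deterministic : ∀ {a b c d c′ d′ T′ T″} → FlipT T a b c d T′ → FlipT T a b c′ d′ T″ →
    c ≡ c′ × d ≡ d′ × T′ ≡ T″
  flip-deterministic (_ , _ , _ , q₁ , norm₁ , refl) (_ , _ , _ , q₂ , norm₂ , refl) with quad-unique q₁ q₂
  ... | refl , refl with trans (sym norm₁) norm₂
  ...   | refl = refl , refl , refl

  flip-injective : ∀ {a b c d e f g h T′} → FlipT T a b e f T′ → FlipT T c d g h T′ → a ≡ c × b ≡ d
  flip-injective {a} {b} {c} {d} {g = g} {h} f₁ f₂@(_ , _ , _ , _ , _ , refl) with sameEntry? a b c d
  ... | yes ab=cd = ab=cd
  ... | no ¬ab=cd = ⊥-elim (FlipFacts.¬mem-old (flip-facts f₁) (mem-replace⁺ T c d g h a b (proj₁ f₁) ¬ab=cd))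

module WholePolygon {m : ℕ} (0<m : 0 < m) (T : DSet (suc m)) (tri : IsTriangulation T) where
  open Triangulation T tri

  private
    last : Fin (suc m)
    last = fromℕ m

    within-polygon : ∀ {a b} → mem T a b → Within fzero last a b
    within-polygon {a} {b} mab = z≤n , subst (⟦ b ⟧ ≤_) (sym (toℕ-fromℕ m)) (≤-pred (toℕ<n b)) , ¬sides
      where
      ¬sides : ¬ (a ≡ fzero × b ≡ last)
      ¬sides (refl , refl) with proj₂ (mem⇒IsDiag mab)
      ... | inj₁ 0<0 = n≮0 0<0
      ... | inj₂ last+1<n = <-irrefl (cong suc (toℕ-fromℕ m)) last+1<n

    polygon : Region fzero last
    polygon = region (suc m) fzero last (m≤n⇒m≤1+n (≤-reflexive (toℕ-fromℕ m)))
                     (subst (0 <_) (sym (toℕ-fromℕ m)) 0<m)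
                     (inj₁ (inj₂ (inj₂ (inj₁ (refl , cong suc (toℕ-fromℕ m))))))
    module polygon = Region polygon

  diagonals : List (Fin (suc m) × Fin (suc m))
  diagonals = polygon.diagonals

  length-diagonals : length diagonals ≡ suc m ∸ 3
  length-diagonals = trans polygon.length-diagonals (cong (_∸ 2) (toℕ-fromℕ m))

  diagonals-unique : Unique diagonals
  diagonals-unique = polygon.unique

  ∈-diagonals⁻ : ∀ {a b} → (a , b) ∈ diagonals → mem T a b
  ∈-diagonals⁻ = proj₁ ∘′ polygon.∈⁻

  ∈-diagonals⁺ : ∀ {a b} → mem T a b → (a , b) ∈ diagonals
  ∈-diagonals⁺ mab = polygon.∈⁺ mab (within-polygon mab)

  quad-exists : ∀ {a b} → mem T a b → ∃[ a′ ] ∃[ b′ ] Quad T a b a′ b′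
  quad-exists {a} {b} mab =
    let open InnerApex (innerApex a b (proj₁ (mem⇒IsDiag mab)) (noncrossing mab))
        b′ , outside , b-b′ , b′-a = polygon.outer mab (within-polygon mab)
    in apex , b′ , (p<apex , apex<q) , outside , p-apex , apex-q , b-b′ , b′-a

-- Pairs of disjoint triangulations

Disjoint-sym : ∀ {n} {S T : DSet n} → Disjoint S T → Disjoint T S
Disjoint-sym disjoint a b m₁ m₂ = disjoint a b m₂ m₁

quad-of-sides⇒n≡4 : ∀ {n} {a b a′ b′ : Fin n} →
  ⟦ a ⟧ < ⟦ a′ ⟧ → ⟦ a′ ⟧ < ⟦ b ⟧ → (⟦ b ⟧ < ⟦ b′ ⟧ ⊎ ⟦ b′ ⟧ < ⟦ a ⟧) →
  Side a a′ → Side a′ b → Side b b′ → Side b′ a → n ≡ 4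
quad-of-sides⇒n≡4 {n} {a} {b} {a′} {b′} a<a′ a′<b outside s₁ s₂ s₃ s₄ with Side-cases a<a′ s₁ | Side-cases a′<b s₂
... | inj₂ w | _ = ⊥-elim (<⇒¬Wrapʳ {z = b} a′<b w)
... | inj₁ _ | inj₂ w = ⊥-elim (<⇒¬Wrapˡ {z = a} a<a′ w)
... | inj₁ e₁ | inj₁ e₂ with outside
...   | inj₁ b<b′ with Side-cases b<b′ s₃ | Side-cases (<-trans (<-trans a<a′ a′<b) b<b′) (Side-sym s₄)
...     | inj₂ w | _ = ⊥-elim (<⇒¬Wrapˡ {z = a′} a′<b w)
...     | inj₁ _ | inj₁ e₄ = ⊥-elim (<⇒≢ᶠ (<-trans a′<b b<b′) (toℕ-injective (trans (sym e₁) e₄)))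
...     | inj₁ e₃ | inj₂ (a≡0 , b′+1≡n) = begin
          n            ≡⟨ b′+1≡n ⟨
          suc ⟦ b′ ⟧   ≡⟨ cong suc e₃ ⟨
          2 + ⟦ b ⟧    ≡⟨ cong (2 +_) e₂ ⟨
          3 + ⟦ a′ ⟧   ≡⟨ cong (3 +_) e₁ ⟨
          4 + ⟦ a ⟧    ≡⟨ cong (4 +_) a≡0 ⟩
          4            ∎
  where open ≡-Reasoning
quad-of-sides⇒n≡4 {n} {a} {b} {a′} {b′} a<a′ a′<b outside s₁ s₂ s₃ s₄
  | inj₁ e₁ | inj₁ e₂ | inj₂ b′<a
  with Side-cases b′<a s₄ | Side-cases (<-trans b′<a (<-trans a<a′ a′<b)) (Side-sym s₃)
... | inj₂ w | _ = ⊥-elim (<⇒¬Wrapʳ {z = b} (<-trans a<a′ a′<b) w)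
... | inj₁ e₄ | inj₁ e₃ = ⊥-elim (<⇒≢ᶠ (<-trans a<a′ a′<b) (toℕ-injective (trans (sym e₄) e₃)))
... | inj₁ e₄ | inj₂ (b′≡0 , b+1≡n) = begin
      n            ≡⟨ b+1≡n ⟨
      suc ⟦ b ⟧    ≡⟨ cong suc e₂ ⟨
      2 + ⟦ a′ ⟧   ≡⟨ cong (2 +_) e₁ ⟨
      3 + ⟦ a ⟧    ≡⟨ cong (3 +_) e₄ ⟨
      4 + ⟦ b′ ⟧   ≡⟨ cong (4 +_) b′≡0 ⟩
      4            ∎
  where open ≡-Reasoning

-- the flip at (a , b) in the first of the disjoint triangulations (T , U), as in PairFlip
FlipAt : ∀ {n} → DSet n → DSet n → Fin n → Fin n → DSet n → DSet n → Set
FlipAt T U a b T′ U′ = ∃[ c ] ∃[ d ] (FlipT T a b c d T′ ×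
  ((mem U c d × ∃[ c′ ] ∃[ d′ ] FlipT U c d c′ d′ U′) ⊎ (¬ mem U c d × U′ ≡ U)))

module DisjointTriangulations {n} (T U : DSet n) (tT : IsTriangulation T) (tU : IsTriangulation U)
                              (disjoint : Disjoint T U) where
  private
    module T = Triangulation T tT
    module U = Triangulation U tU

  common-bound⇒Side : ∀ {u v} → Bound T u v → Bound U u v → Side u v
  common-bound⇒Side (inj₁ s) _ = s
  common-bound⇒Side (inj₂ _) (inj₁ s) = s
  common-bound⇒Side (inj₂ (inj₁ m₁)) (inj₂ (inj₁ m₂)) = ⊥-elim (disjoint _ _ m₁ m₂)
  common-bound⇒Side (inj₂ (inj₂ m₁)) (inj₂ (inj₂ m₂)) = ⊥-elim (disjoint _ _ m₁ m₂)
  common-bound⇒Side (inj₂ (inj₁ m₁)) (inj₂ (inj₂ m₂)) = ⊥-elim (<-asym (T.mem⇒< m₁) (U.mem⇒< m₂))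
  common-bound⇒Side (inj₂ (inj₂ m₁)) (inj₂ (inj₁ m₂)) = ⊥-elim (<-asym (T.mem⇒< m₁) (U.mem⇒< m₂))

  flip-not-undone : 5 ≤ n → ∀ {a b e f T′ U′} → FlipT T a b e f T′ → FlipT U e f a b U′ → ⊥
  flip-not-undone 5≤n {a} {b} {e} {f}
    (_ , a′ , b′ , ((a<a′ , a′<b) , outside , t₁ , t₂ , t₃ , t₄) , norm₁ , _)
    (_ , x , y , (_ , _ , u₁ , u₂ , u₃ , u₄) , norm₂ , _) =
    sides-match (norm-cases norm₁) (norm-cases norm₂) u₁ u₂ u₃ u₄
    where
    common : Bound U a a′ → Bound U a′ b → Bound U b b′ → Bound U b′ a → ⊥
    common v₁ v₂ v₃ v₄ = <⇒≢ 5≤n (sym (quad-of-sides⇒n≡4 a<a′ a′<b outside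
      (common-bound⇒Side t₁ v₁) (common-bound⇒Side t₂ v₂) (common-bound⇒Side t₃ v₃) (common-bound⇒Side t₄ v₄)))
    ↔ : ∀ {u v} → Bound U u v → Bound U v u
    ↔ = Bound-sym {S = U}
    sides-match : (a′ ≡ e × b′ ≡ f) ⊎ (a′ ≡ f × b′ ≡ e) → (x ≡ a × y ≡ b) ⊎ (x ≡ b × y ≡ a) →
      Bound U e x → Bound U x f → Bound U f y → Bound U y e → ⊥
    sides-match (inj₁ (refl , refl)) (inj₁ (refl , refl)) v₁ v₂ v₃ v₄ = common (↔ v₁) (↔ v₄) (↔ v₃) (↔ v₂)
    sides-match (inj₁ (refl , refl)) (inj₂ (refl , refl)) v₁ v₂ v₃ v₄ = common v₄ v₁ v₂ v₃
    sides-match (inj₂ (refl , refl)) (inj₁ (refl , refl)) v₁ v₂ v₃ v₄ = common v₂ v₃ v₄ v₁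
    sides-match (inj₂ (refl , refl)) (inj₂ (refl , refl)) v₁ v₂ v₃ v₄ = common (↔ v₃) (↔ v₂) (↔ v₁) (↔ v₄)

  FlipAt-injective : ∀ {a b c d T′ U′ U″} → FlipAt T U a b T′ U′ → FlipAt T U c d T′ U″ → a ≡ c × b ≡ d
  FlipAt-injective (_ , _ , f₁ , _) (_ , _ , f₂ , _) = T.flip-injective f₁ f₂

  FlipAt-sides-differ : 5 ≤ n → ∀ {a b c d T′ U′} → FlipAt T U a b T′ U′ → ¬ FlipAt U T c d U′ T′
  FlipAt-sides-differ _ (_ , _ , f₁ , _) (_ , _ , _ , inj₂ (_ , refl)) = T.flip-irreflexive f₁
  FlipAt-sides-differ _ (_ , _ , _ , inj₂ (_ , refl)) (_ , _ , f₂ , inj₁ _) = U.flip-irreflexive f₂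
  FlipAt-sides-differ 5≤n (_ , _ , f₁ , inj₁ (_ , _ , _ , g₁)) (_ , _ , f₂ , inj₁ (_ , _ , _ , g₂))
    with T.flip-injective f₁ g₂ | U.flip-injective f₂ g₁
  ... | refl , refl | refl , refl = flip-not-undone 5≤n f₁ f₂

  FlipAt-deterministic : ∀ {a b T′ U′ T″ U″} → FlipAt T U a b T′ U′ → FlipAt T U a b T″ U″ → T′ ≡ T″ × U′ ≡ U″
  FlipAt-deterministic (_ , _ , f₁ , s₁) (_ , _ , f₂ , s₂) with T.flip-deterministic f₁ f₂
  ... | refl , refl , refl = refl , passive s₁ s₂
    where
    passive : ∀ {c d U′ U″} → (mem U c d × ∃[ c′ ] ∃[ d′ ] FlipT U c d c′ d′ U′) ⊎ (¬ mem U c d × U′ ≡ U) →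
      (mem U c d × ∃[ c′ ] ∃[ d′ ] FlipT U c d c′ d′ U″) ⊎ (¬ mem U c d × U″ ≡ U) → U′ ≡ U″
    passive (inj₁ (_ , _ , _ , g₁)) (inj₁ (_ , _ , _ , g₂)) = proj₂ (proj₂ (U.flip-deterministic g₁ g₂))
    passive (inj₁ (mu , _)) (inj₂ (¬mu , _)) = contradiction mu ¬mu
    passive (inj₂ (¬mu , _)) (inj₁ (mu , _)) = contradiction mu ¬mu
    passive (inj₂ (_ , refl)) (inj₂ (_ , refl)) = refl

  FlipAt-reverse : ∀ {a b T′ U′} → FlipAt T U a b T′ U′ →
    (∃[ c ] ∃[ d ] FlipAt T′ U′ c d T U) ⊎ (∃[ c ] ∃[ d ] FlipAt U′ T′ c d U T)
  FlipAt-reverse {a} {b} (c , d , f , inj₂ (_ , refl)) =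
    inj₁ (c , d , a , b , T.FlipFacts.reverse (T.flip-facts f) , inj₂ (disjoint a b (proj₁ f) , refl))
  FlipAt-reverse {a} {b} (c , d , f , inj₁ (_ , c′ , d′ , g)) =
    inj₂ (c′ , d′ , c , d , U.FlipFacts.reverse (U.flip-facts g) ,
          inj₁ (T.FlipFacts.mem-new (T.flip-facts f) , a , b , T.FlipFacts.reverse (T.flip-facts f)))

  record FlipOutcome (a b : Fin n) : Set where
    field
      {T′ U′} : DSet n
      flip : FlipAt T U a b T′ U′
      triangulation₁ : IsTriangulation T′
      triangulation₂ : IsTriangulation U′
      disjoint′ : Disjoint T′ U′

  flip-outcome-unchanged : ∀ {a b c d T′} → FlipT T a b c d T′ → ¬ mem U c d → FlipOutcome a b
  flip-outcome-unchanged {a} {b} {c} {d} f@(_ , _ , _ , _ , _ , refl) ¬mu = record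
    { flip = c , d , f , inj₂ (¬mu , refl)
    ; triangulation₁ = T.FlipFacts.triangulation (T.flip-facts f)
    ; triangulation₂ = tU
    ; disjoint′ = disjoint′
    }
    where
    disjoint′ : Disjoint (replace T a b (c , d)) U
    disjoint′ x y m₁ m₂ with mem-replace⁻ T a b c d x y m₁
    ... | inj₁ (refl , refl) = ¬mu m₂
    ... | inj₂ (m₁′ , _) = disjoint x y m₁′ m₂

  flip-outcome-flipped : ∀ {a b c d c′ d′ T′ U′} → FlipT T a b c d T′ → FlipT U c d c′ d′ U′ → FlipOutcome a b
  flip-outcome-flipped {a} {b} {c} {d} {c′} {d′}
                       f@(_ , _ , _ , _ , _ , refl) g@(mu , _ , _ , _ , _ , refl) = record
    { flip = c , d , f , inj₁ (mu , c′ , d′ , g)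
    ; triangulation₁ = Fᵀ.triangulation
    ; triangulation₂ = Gᵁ.triangulation
    ; disjoint′ = disjoint′
    }
    where
    module Fᵀ = T.FlipFacts (T.flip-facts f)
    module Gᵁ = U.FlipFacts (U.flip-facts g)
    disjoint′ : Disjoint (replace T a b (c , d)) (replace U c d (c′ , d′))
    disjoint′ x y m₁ m₂ with mem-replace⁻ T a b c d x y m₁ | mem-replace⁻ U c d c′ d′ x y m₂
    ... | inj₁ (refl , refl) | inj₁ (refl , refl) = Gᵁ.¬mem-new mu
    ... | inj₁ (refl , refl) | inj₂ (_ , ¬cd) = ¬cd (refl , refl)
    ... | inj₂ _ | inj₁ (refl , refl) = proj₁ (proj₂ Fᵀ.triangulation) c d x y Fᵀ.mem-new m₁ Gᵁ.crosses
    ... | inj₂ (m₁′ , _) | inj₂ (m₂′ , _) = disjoint x y m₁′ m₂′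

module PolygonFlips {m} (0<m : 0 < m) (T U : DSet (suc m)) (tT : IsTriangulation T) (tU : IsTriangulation U)
                    (disjoint : Disjoint T U) where
  open DisjointTriangulations T U tT tU disjoint

  flip-exists : ∀ {a b} → mem T a b → FlipOutcome a b
  flip-exists mab with WholePolygon.quad-exists 0<m T tT mab
  ... | a′ , b′ , q with norm a′ b′ in norm≡
  ...   | c , d with mem? U c d
  ...     | no ¬mu = flip-outcome-unchanged (mab , a′ , b′ , q , norm≡ , refl) ¬mu
  ...     | yes mu with WholePolygon.quad-exists 0<m U tU mu
  ...       | x , y , q′ with norm x y in norm′≡
  ...         | c′ , d′ =
    flip-outcome-flipped (mab , a′ , b′ , q , norm≡ , refl) (mu , x , y , q′ , norm′≡ , refl)

-- The neighbours of a vertex of the flip graph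

map-unique : ∀ {A B : Set} (f : A → B) {xs : List A} → Unique xs →
  (∀ {x y} → x ∈ xs → y ∈ xs → f x ≡ f y → x ≡ y) → Unique (map f xs)
map-unique f [] _ = []
map-unique f (x∉xs ∷ unique) injective =
  All-map⁺ (All.tabulate λ y∈ fx≡fy → All.lookup x∉xs y∈ (injective (here refl) (there y∈) fx≡fy)) ∷
  map-unique f unique λ x∈ y∈ → injective (there x∈) (there y∈)

module _ {n : ℕ} where

  vertex-triangulation : ∀ {Q : Pair n} → IsVertex Q → ∀ i → IsTriangulation (comp Q i)
  vertex-triangulation vQ one = proj₁ vQ
  vertex-triangulation vQ two = proj₁ (proj₂ vQ)

  vertex-disjoint : ∀ {Q : Pair n} → IsVertex Q → ∀ i → Disjoint (comp Q i) (comp Q (other i))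
  vertex-disjoint vQ one = proj₂ (proj₂ vQ)
  vertex-disjoint {Q} vQ two = Disjoint-sym {S = proj₁ Q} {T = proj₂ Q} (proj₂ (proj₂ vQ))

  module AtVertex (P : Pair n) (vP : IsVertex P) (i : Which) =
    DisjointTriangulations (comp P i) (comp P (other i))
      (vertex-triangulation vP i) (vertex-triangulation vP (other i)) (vertex-disjoint vP i)

  pair-ext : ∀ {Q Q′ : Pair n} i → comp Q i ≡ comp Q′ i → comp Q (other i) ≡ comp Q′ (other i) → Q ≡ Q′
  pair-ext one e₁ e₂ = cong₂ _,_ e₁ e₂
  pair-ext two e₁ e₂ = cong₂ _,_ e₂ e₁

  PairFlip-deterministic : ∀ {P Q Q′ : Pair n} {i a b} → IsVertex P →
    PairFlip P i a b Q → PairFlip P i a b Q′ → Q ≡ Q′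
  PairFlip-deterministic {P} {i = i} vP p p′ =
    let e₁ , e₂ = AtVertex.FlipAt-deterministic P vP i p p′ in pair-ext i e₁ e₂

  PairFlip-reverse : ∀ {P Q : Pair n} {i a b} → IsVertex Q → PairFlip Q i a b P →
    ∃[ j ] ∃[ c ] ∃[ d ] PairFlip P j c d Q
  PairFlip-reverse {Q = Q} {i = one} vQ p with AtVertex.FlipAt-reverse Q vQ one p
  ... | inj₁ (c , d , p′) = one , c , d , p′
  ... | inj₂ (c , d , p′) = two , c , d , p′
  PairFlip-reverse {Q = Q} {i = two} vQ p with AtVertex.FlipAt-reverse Q vQ two p
  ... | inj₁ (c , d , p′) = two , c , d , p′
  ... | inj₂ (c , d , p′) = one , c , d , p′

module Neighbourhood {m : ℕ} (5≤n : 5 ≤ suc m) (P : Pair (suc m)) (vP : IsVertex P) where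
  private
    0<m : 0 < m
    0<m = ≤-trans (s≤s z≤n) (≤-pred 5≤n)
    module At = AtVertex P vP
    module Whole (i : Which) = WholePolygon 0<m (comp P i) (vertex-triangulation vP i)
    flip-irreflexive : ∀ i {a b c d} → ¬ FlipT (comp P i) a b c d (comp P i)
    flip-irreflexive i = Triangulation.flip-irreflexive (comp P i) (vertex-triangulation vP i)
    module Polygon (i : Which) = PolygonFlips 0<m (comp P i) (comp P (other i))
      (vertex-triangulation vP i) (vertex-triangulation vP (other i)) (vertex-disjoint vP i)

  flips-to-vertex : ∀ i a b → mem (comp P i) a b → ∃[ Q ] (PairFlip P i a b Q × IsVertex Q)
  flips-to-vertex one a b mab =
    let open At.FlipOutcome one (Polygon.flip-exists one mab)
    in (T′ , U′) , flip , triangulation₁ , triangulation₂ , disjoint′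
  flips-to-vertex two a b mab =
    let open At.FlipOutcome two (Polygon.flip-exists two mab)
    in (U′ , T′) , flip , triangulation₂ , triangulation₁ , Disjoint-sym {S = T′} {T = U′} disjoint′

  no-loop : ¬ Adj P P
  no-loop (_ , _ , inj₁ (i , _ , _ , _ , _ , f , _)) = flip-irreflexive i f
  no-loop (_ , _ , inj₂ (i , _ , _ , _ , _ , f , _)) = flip-irreflexive i f

  flips-distinct : ∀ i j a b c d Q → PairFlip P i a b Q → PairFlip P j c d Q → i ≡ j × a ≡ c × b ≡ d
  flips-distinct one one _ _ _ _ _ p₁ p₂ = refl , At.FlipAt-injective one p₁ p₂
  flips-distinct two two _ _ _ _ _ p₁ p₂ = refl , At.FlipAt-injective two p₁ p₂
  flips-distinct one two _ _ _ _ _ p₁ p₂ = ⊥-elim (At.FlipAt-sides-differ one 5≤n p₁ p₂)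
  flips-distinct two one _ _ _ _ _ p₁ p₂ = ⊥-elim (At.FlipAt-sides-differ two 5≤n p₁ p₂)

  -- P is a junk value: neighbour i is only applied to diagonals of comp P i
  neighbour : Which → Fin (suc m) × Fin (suc m) → Pair (suc m)
  neighbour i (a , b) with mem? (comp P i) a b
  ... | yes mab = proj₁ (flips-to-vertex i a b mab)
  ... | no _ = P

  neighbour-flip : ∀ i a b → mem (comp P i) a b →
    PairFlip P i a b (neighbour i (a , b)) × IsVertex (neighbour i (a , b))
  neighbour-flip i a b mab with mem? (comp P i) a b
  ... | yes mab′ = proj₂ (flips-to-vertex i a b mab′)
  ... | no ¬mab = contradiction mab ¬mab

  neighbours-via : Which → List (Pair (suc m))
  neighbours-via i = map (neighbour i) (Whole.diagonals i)

  neighbours : List (Pair (suc m))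
  neighbours = neighbours-via one ++ neighbours-via two

  length-neighbours : length neighbours ≡ 2 * (suc m ∸ 3)
  length-neighbours = begin
    length (neighbours-via one ++ neighbours-via two)
      ≡⟨ length-++ (neighbours-via one) ⟩
    length (neighbours-via one) + length (neighbours-via two)
      ≡⟨ cong₂ _+_ (length-via one) (length-via two) ⟩
    (suc m ∸ 3) + (suc m ∸ 3)
      ≡⟨ cong ((suc m ∸ 3) +_) (+-identityʳ _) ⟨
    2 * (suc m ∸ 3)
      ∎
    where
    open ≡-Reasoning
    length-via : ∀ i → length (neighbours-via i) ≡ suc m ∸ 3
    length-via i = trans (length-map (neighbour i) (Whole.diagonals i)) (Whole.length-diagonals i)

  private
    neighbour-injective : ∀ i {x y} → x ∈ Whole.diagonals i → y ∈ Whole.diagonals i →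
      neighbour i x ≡ neighbour i y → x ≡ y
    neighbour-injective i {a , b} {c , d} x∈ y∈ e
      with flips-distinct i i a b c d _ (proj₁ (neighbour-flip i a b (Whole.∈-diagonals⁻ i x∈)))
             (subst (PairFlip P i c d) (sym e) (proj₁ (neighbour-flip i c d (Whole.∈-diagonals⁻ i y∈))))
    ... | _ , refl , refl = refl

    via-disjoint : ∀ {Q} → ¬ (Q ∈ neighbours-via one × Q ∈ neighbours-via two)
    via-disjoint (Q∈₁ , Q∈₂) with ∈-map⁻ (neighbour one) Q∈₁ | ∈-map⁻ (neighbour two) Q∈₂
    ... | (a , b) , ab∈ , refl | (c , d) , cd∈ , e
      with flips-distinct one two a b c d _ (proj₁ (neighbour-flip one a b (Whole.∈-diagonals⁻ one ab∈)))
             (subst (PairFlip P two c d) (sym e) (proj₁ (neighbour-flip two c d (Whole.∈-diagonals⁻ two cd∈))))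
    ... | () , _

  neighbours-unique : Unique neighbours
  neighbours-unique =
    ++⁺ (map-unique (neighbour one) (Whole.diagonals-unique one) (neighbour-injective one))
        (map-unique (neighbour two) (Whole.diagonals-unique two) (neighbour-injective two))
        via-disjoint

  private
    ∈-via⇒Adj : ∀ i {Q} → Q ∈ neighbours-via i → Adj P Q
    ∈-via⇒Adj i Q∈ with ∈-map⁻ (neighbour i) Q∈
    ... | (a , b) , ab∈ , refl =
      let flip , vQ = neighbour-flip i a b (Whole.∈-diagonals⁻ i ab∈) in vP , vQ , inj₁ (i , a , b , flip)

    ∈-via⇒∈ : ∀ i {Q} → Q ∈ neighbours-via i → Q ∈ neighbours
    ∈-via⇒∈ one = ∈-++⁺ˡ
    ∈-via⇒∈ two = ∈-++⁺ʳ (neighbours-via one)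

    flip⇒∈neighbours : ∀ i a b {Q} → PairFlip P i a b Q → Q ∈ neighbours
    flip⇒∈neighbours i a b {Q} p@(_ , _ , (mab , _) , _) =
      ∈-via⇒∈ i (subst (_∈ neighbours-via i) Q≡ (∈-map⁺ (neighbour i) (Whole.∈-diagonals⁺ i mab)))
      where
      Q≡ : neighbour i (a , b) ≡ Q
      Q≡ = PairFlip-deterministic {P = P} {i = i} {a} {b} vP (proj₁ (neighbour-flip i a b mab)) p

  ∈-neighbours⇔Adj : ∀ Q → Q ∈ neighbours ⇔ Adj P Q
  ∈-neighbours⇔Adj Q = mk⇔ ∈⇒Adj Adj⇒∈
    where
    ∈⇒Adj : Q ∈ neighbours → Adj P Q
    ∈⇒Adj Q∈ with ∈-++⁻ (neighbours-via one) Q∈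
    ... | inj₁ Q∈₁ = ∈-via⇒Adj one Q∈₁
    ... | inj₂ Q∈₂ = ∈-via⇒Adj two Q∈₂
    Adj⇒∈ : Adj P Q → Q ∈ neighbours
    Adj⇒∈ (_ , _ , inj₁ (i , a , b , p)) = flip⇒∈neighbours i a b p
    Adj⇒∈ (_ , vQ , inj₂ (i , a , b , p)) =
      let j , c , d , p′ = PairFlip-reverse {P = P} {Q} {i} {a} {b} vQ p in flip⇒∈neighbours j c d p′

lemma4p4 : (n : ℕ) → 5 ≤ n → (P : Pair n) → IsVertex P →
    -- every one of the 2(n-3) flips yields a vertex of D_n
    (∀ (i : Which) (a b : Fin n) → mem (comp P i) a b →
       ∃[ Q ] (PairFlip P i a b Q × IsVertex Q))
    -- no loops
  × ¬ Adj P P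
    -- no multiple edges: distinct flips give distinct pairs
  × (∀ (i j : Which) (a b c d : Fin n) (Q : Pair n) →
       PairFlip P i a b Q → PairFlip P j c d Q →
       (i ≡ j × a ≡ c × b ≡ d))
    -- 2(n-3)-regular: exactly 2(n-3) neighbours
  × (∃[ L ] (length L ≡ 2 * (n ∸ 3) × Unique L ×
       (∀ (Q : Pair n) → (Q ∈ L) ⇔ Adj P Q)))
lemma4p4 zero () _ _
lemma4p4 (suc m) 5≤n P vP =
  flips-to-vertex , no-loop , flips-distinct ,
  neighbours , length-neighbours , neighbours-unique , ∈-neighbours⇔Adj
  where open Neighbourhood 5≤n P vP
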